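{- Let $R$ be a commutative ring with unit and $M$ a locally finite monoid with zero. The algebra $R_0[[M]]$ endowed with the topology $\mathcal{F}$ defined by the filtration $(\mathfrak{M}_{\ge n})_{n\in\mathbb{N}}$ is complete.
   Context: A monoid with zero is a monoid $M$, $|M|\ge2$, with a two-sided absorbing element $0_M\ne 1_M$; $M_0=M\setminus\{0_M\}$, $M^+=M\setminus\{1_M\}$. $M$ is a locally finite monoid with zero if for every $x\in M_0$ the set $\{(n,x_1,\dots,x_n): x=x_1\cdots x_n,\ x_i\neq 1_M\}$ is finite. $R_0[[M]]$ is the algebra of functions $f:M\to R$ with $f(0_M)=0$, with product $\langle fg,x\rangle=\sum_{yz=x}\langle f,y\rangle\langle g,z\rangle$ for $x\in M_0$ (where $\langle f,x\rangle=f(x)$). For $x\in M_0$, $\omega_M(x)=\max\{n: \exists x_1,\dots,x_n\in M^+,\ x=x_1\cdots x_n\}$; $\omega(f)=\inf\{\omega_M(x): x\in M_0,\ \langle f,x\rangle\ne0\}$; $\mathfrak{M}_{\ge n}=\{f:\omega(f)\ge n\}$. The topology $\mathcal{F}$ is the (linear) topology in which the ideals $\mathfrak{M}_{\ge n}$ form a fundamental system of neighbourhoods of $0$. -}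

module Defs where

open import Level using (Level; _⊔_; suc)
open import Data.Nat using (ℕ; _≤_; _<_)
open import Data.Product using (Σ; ∃; _×_; _,_; proj₁)
open import Data.List using (List; []; _∷_; foldr; length)
open import Data.List.Relation.Unary.All using (All)
open import Data.List.Membership.Propositional using (_∈_)
open import Relation.Binary.PropositionalEquality using (_≡_; _≢_)
open import Algebra.Bundles using (CommutativeRing)
open import Algebra.Structures using (IsMonoid)

record MonoidWithZero (m : Level) : Set (suc m) where
  field
    Carrier  : Set m
    _∙_      : Carrier → Carrier → Carrier
    ε        : Carrier
    0M       : Carrier
    isMonoid : IsMonoid _≡_ _∙_ ε
    zeroˡ    : ∀ x → 0M ∙ x ≡ 0M
    zeroʳ    : ∀ x → x ∙ 0M ≡ 0M
    0≢1      : 0M ≢ ε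

module _ {m : Level} (M : MonoidWithZero m) where
  open MonoidWithZero M

  prod : List Carrier → Carrier
  prod = foldr _∙_ ε

  Factorization : Carrier → List Carrier → Set m
  Factorization x xs = All (λ y → y ≢ ε) xs × prod xs ≡ x

  LocallyFinite : Set m
  LocallyFinite = ∀ x → x ≢ 0M →
    ∃ λ (L : List (List Carrier)) → ∀ xs → Factorization x xs → xs ∈ L

  -- ω_M(x) < n  (ω_M(x) is the maximal length of such a factorization)
  ωLt : Carrier → ℕ → Set m
  ωLt x n = ∀ xs → Factorization x xs → length xs < n

  M₀ : Set m
  M₀ = Σ Carrier (λ x → x ≢ 0M)

module _ {c ℓ m : Level} (R : CommutativeRing c ℓ) (M : MonoidWithZero m) where
  open CommutativeRing R renaming (Carrier to R∣)
  open MonoidWithZero M using (Carrier; 0M)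

  -- R₀[[M]]: functions M → R vanishing at 0_M, represented as functions on M₀
  Series : Set (m ⊔ c)
  Series = M₀ M → R∣

  _⊝_ : Series → Series → Series
  (f ⊝ g) x = f x - g x

  In𝔐≥ : ℕ → Series → Set (m ⊔ ℓ)
  In𝔐≥ n f = ∀ (x : M₀ M) → ωLt M (proj₁ x) n → f x ≈ 0#

  IsCauchy : (ℕ → Series) → Set (m ⊔ ℓ)
  IsCauchy s = ∀ n → ∃ λ N → ∀ p q → N ≤ p → N ≤ q → In𝔐≥ n (s p ⊝ s q)

  ConvergesTo : (ℕ → Series) → Series → Set (m ⊔ ℓ)
  ConvergesTo s f = ∀ n → ∃ λ N → ∀ p → N ≤ p → In𝔐≥ n (s p ⊝ f)

  Complete : Set (m ⊔ c ⊔ ℓ)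
  Complete = ∀ (s : ℕ → Series) → IsCauchy s → ∃ λ f → ConvergesTo s f

module Submission where

-- Local finiteness means that every x ∈ M₀ has only finitely many
-- factorizations into elements of M⁺, so ω_M(x) is bounded by some h(x).
-- For a Cauchy sequence (sₙ) and the index N(k) from which all differences
-- lie in 𝔐_{≥k}, the coefficient at x of sₚ is therefore independent of
-- p ≥ N(h(x)): the sequence is eventually constant coordinatewise, and the
-- limit is f(x) = s_{N(h(x))}(x).

open import Defs
open import Level using (Level)
open import Algebra.Bundles using (CommutativeRing)
open import Data.Nat using (ℕ; _≤_; _⊔_; s≤s; suc)
open import Data.Nat.Properties using (m≤m⊔n; m≤n⊔m; ≤-trans; ≤-refl)
open import Data.Product using (Σ; _,_; proj₁; proj₂)
open import Data.List using (List; []; _∷_; length)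
open import Data.List.Relation.Unary.Any using (here; there)
open import Data.List.Membership.Propositional using (_∈_)
open import Relation.Binary.PropositionalEquality using (refl)
import Algebra.Properties.Group as GroupProperties

maxLength : ∀ {a} {A : Set a} → List (List A) → ℕ
maxLength []       = 0
maxLength (xs ∷ L) = length xs ⊔ maxLength L

maxLength-∈ : ∀ {a} {A : Set a} {xs : List A} (L : List (List A)) →
              xs ∈ L → length xs ≤ maxLength L
maxLength-∈ (_ ∷ _) (here refl) = m≤m⊔n _ _
maxLength-∈ (_ ∷ L) (there p)   = ≤-trans (maxLength-∈ L p) (m≤n⊔m _ _)

finiteHeight : ∀ {m} (M : MonoidWithZero m) → LocallyFinite M →
               (x : M₀ M) → Σ ℕ (ωLt M (proj₁ x))
finiteHeight M lf (x , x≢0) = suc (maxLength factorizations) , bounded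
  where
  factorizations : List (List (MonoidWithZero.Carrier M))
  factorizations = proj₁ (lf x x≢0)
  bounded : ωLt M x (suc (maxLength factorizations))
  bounded xs fac = s≤s (maxLength-∈ factorizations (proj₂ (lf x x≢0) xs fac))

-- Vanishing of a difference is transitive, since a - b ≈ 0 ⇔ a ≈ b in the
-- additive group; this is what lets the limit be compared with sₚ through
-- an intermediate term of the sequence.
module _ {c ℓ} (R : CommutativeRing c ℓ) where
  open CommutativeRing R
  open GroupProperties +-group using (x∙y⁻¹≈ε⇒x≈y; x≈y⇒x∙y⁻¹≈ε)

  difference-trans : ∀ a b d → a - b ≈ 0# → b - d ≈ 0# → a - d ≈ 0#
  difference-trans a b d a≈b b≈d =
    x≈y⇒x∙y⁻¹≈ε (trans (x∙y⁻¹≈ε⇒x≈y a b a≈b) (x∙y⁻¹≈ε⇒x≈y b d b≈d))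

mainTheorem4 : ∀ {c ℓ m : Level} (R : CommutativeRing c ℓ) (M : MonoidWithZero m) →
    LocallyFinite M → Complete R M
mainTheorem4 R M lf s cauchy = limit , converges
  where
  N : ℕ → ℕ
  N k = proj₁ (cauchy k)

  height : M₀ M → ℕ
  height x = proj₁ (finiteHeight M lf x)

  limit : Series R M
  limit x = s (N (height x)) x

  converges : ConvergesTo R M s limit
  converges n = N n , λ p N≤p x ωx<n →
    let q = N (height x)
        r = p ⊔ q
        sₚ≈sᵣ = proj₂ (cauchy n) p r N≤p (≤-trans N≤p (m≤m⊔n p q)) x ωx<n
        sᵣ≈s_N = proj₂ (cauchy (height x)) r q (m≤n⊔m p q) ≤-refl x
                   (proj₂ (finiteHeight M lf x))
    in difference-trans R (s p x) (s r x) (s q x) sₚ≈sᵣ sᵣ≈s_N
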